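{- Consider the synchronous self-jamming singing protocol on a dynamic network. Suppose agent $v$ is incident to an edge that is not affected in the beginning of round $i+1$ nor in the beginning of round $i+2$. If $v$ has a neighbor $u$ that is in state $\textsc{Un}$ in round $i+2$, then $u$ was active in round $i$.
   Context: Agents are the vertices of an undirected communication graph; agents know nothing about the graph. Each agent is in one of three states $\{\textsc{Out},\textsc{In},\textsc{Un}\}$ and operates in synchronous rounds (all rounds start and end simultaneously; every note sung in a round is heard by all neighbors by the end of the round). Self-jamming communication: an agent hears the union of notes sung by its neighbors except the notes it sings itself (presence only, not multiplicity). Self-jamming singing protocol (one round, agent in state $s$): compute a fresh $\ell$-value by flipping a fair coin until the first $0$, $\ell$ = number of flips. If $s=\textsc{Out}$: sing nothing, listen for note $0$. If $s=\textsc{In}$: sing even notes $0,2,\dots,2\ell-2$, listen for note $2\ell$. If $s=\textsc{Un}$: sing odd notes $1,3,\dots,2\ell-1$, listen for notes $0$ and $2\ell+1$. End of round: $\textsc{In}$ becomes $\textsc{Un}$ if it heard note $2\ell$, else stays $\textsc{In}$; $\textsc{Un}$ becomes $\textsc{Out}$ if it heard $0$, otherwise stays $\textsc{Un}$ if it heard $2\ell+1$ and becomes $\textsc{In}$ if not; $\textsc{Out}$ stays $\textsc{Out}$ if it heard $0$, else becomes $\textsc{Un}$. Dynamic networks: agents and edges may be inserted or deleted; all such changes are regarded as occurring at the beginning of a round; new agents start in arbitrary states. An agent that changes state arbitrarily or does not execute the protocol correctly at the end of round $i-1$ is modeled as being deleted and reinserted (with its edges) in its new state at the beginning of round $i$.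 An agent is changed in round $i$ if it is incident to an edge added or deleted at the beginning of round $i$. An edge is affected in round $i$ if one of its endpoints is at distance at most $2$ from an agent changed in round $i$. An agent is $\textsc{In}^{\overline{\textsc{In}}}$ in a round if it is $\textsc{In}$ and has no $\textsc{In}$ neighbor in that round. An agent is eliminated in round $i$ if it is $\textsc{In}^{\overline{\textsc{In}}}$ or adjacent to an $\textsc{In}^{\overline{\textsc{In}}}$ agent in round $i$; otherwise active. -}

module Defs where

open import Data.Nat using (ℕ; zero; suc; _+_; _*_; _<_; _≤_)
open import Data.Product using (Σ; ∃; ∃-syntax; _×_; _,_)
open import Data.Sum using (_⊎_; inj₁; inj₂)
open import Data.Empty using (⊥)
open import Relation.Nullary using (¬_)
open import Relation.Binary.PropositionalEquality using (_≡_; _≢_)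

data State : Set where
  Out In Un : State

Sings : State → ℕ → ℕ → Set
Sings Out ℓ k = ⊥
Sings In  ℓ k = ∃[ j ] (j < ℓ × k ≡ 2 * j)
Sings Un  ℓ k = ∃[ j ] (j < ℓ × k ≡ 2 * j + 1)

-- End-of-round transition, as a relation:
-- Step s ℓ heard s'  means: an agent in state s with ℓ-value ℓ, whose set of
-- heard notes is `heard`, may be in state s' in the next round.
Step : State → ℕ → (ℕ → Set) → State → Set
Step Out ℓ heard s' =
  (heard 0 → s' ≡ Out) × (¬ heard 0 → s' ≡ Un)
Step In ℓ heard s' =
  (heard (2 * ℓ) → s' ≡ Un) × (¬ heard (2 * ℓ) → s' ≡ In)
Step Un ℓ heard s' =
  (heard 0 → s' ≡ Out)
  × (¬ heard 0 → heard (2 * ℓ + 1) → s' ≡ Un)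
  × (¬ heard 0 → ¬ heard (2 * ℓ + 1) → s' ≡ In)

-- Agents range over a fixed universe V; agents not
-- currently present simply have no incident edges.  `E i` is the
-- communication graph in round i (after the changes at the beginning of
-- round i).  `reset i v` says that v was (deleted and) reinserted at the
-- beginning of round i in an arbitrary state (new agents, agents that
-- changed state arbitrarily or did not update correctly).
-- The ℓ-values (coin-flip outcomes) are arbitrary positive naturals.
record Execution : Set₁ where
  field
    V      : Set
    E      : ℕ → V → V → Set
    E-sym  : ∀ i u v → E i u v → E i v u
    E-irr  : ∀ i v → ¬ E i v v
    st     : ℕ → V → State
    ℓ      : ℕ → V → ℕ
    ℓ≥1    : ∀ i v → 1 ≤ ℓ i v
    reset  : ℕ → V → Set

  Hears : ℕ → V → ℕ → Set
  Hears i v k = (∃[ w ] (E i w v × Sings (st i w) (ℓ i w) k))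
                × ¬ Sings (st i v) (ℓ i v) k

  field
    protocol : ∀ i v → ¬ reset (suc i) v →
               Step (st i v) (ℓ i v) (Hears i v) (st (suc i) v)

  -- The edge {w,x} is added or deleted at the beginning of round i+1
  -- (including edges of reinserted agents, which are deleted and re-added).
  EdgeChanged : ℕ → V → V → Set
  EdgeChanged zero w x = E zero w x          -- initially all edges are inserted
  EdgeChanged (suc i) w x =
      (E (suc i) w x × ¬ E i w x)
    ⊎ (E i w x × ¬ E (suc i) w x)
    ⊎ ((E i w x ⊎ E (suc i) w x) × (reset (suc i) w ⊎ reset (suc i) x))

  Changed : ℕ → V → Set
  Changed i w = ∃[ x ] EdgeChanged i w x

  Dist≤2 : ℕ → V → V → Set
  Dist≤2 i a c = a ≡ c ⊎ E i a c ⊎ (∃[ x ] (E i a x × E i x c))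

  Affected : ℕ → V → V → Set
  Affected i a b = ∃[ c ] (Changed i c × (Dist≤2 i a c ⊎ Dist≤2 i b c))

  InNoIn : ℕ → V → Set
  InNoIn i x = st i x ≡ In × (∀ y → E i x y → st i y ≢ In)

  Eliminated : ℕ → V → Set
  Eliminated i u = InNoIn i u ⊎ (∃[ x ] (E i u x × InNoIn i x))

  Active : ℕ → V → Set
  Active i u = ¬ Eliminated i u

{-# OPTIONS --safe #-}
-- Suppose u were eliminated in round i.  If u is In without In neighbours,
-- its non-In neighbours hear its note 0 and turn Out, so u is still In
-- without In neighbours in round i+1 and stays In in round i+2.  If u is a
-- neighbour of such an agent x, then u turns Out while x stays In, and u
-- keeps hearing note 0 from x, so u is Out in round i+2.  Either way u is
-- not Un in round i+2.  The hypotheses on the edge {v,w} enter only through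
-- v: they make u, a neighbour of v, unchanged in rounds i+1 and i+2, so the
-- neighbourhood of u persists and neither u nor its neighbours are reset.
module Submission where

open import Defs
open import Data.Nat using (ℕ; suc; _*_)
open import Data.Nat.Properties using (even≢odd; +-comm)
open import Data.Product using (_,_)
open import Data.Sum using (_⊎_; inj₁; inj₂)
open import Relation.Nullary using (¬_; contradiction)
open import Relation.Binary.PropositionalEquality using (_≡_; _≢_; refl; trans; sym)

sings-even⇒In : ∀ s ℓ m → Sings s ℓ (2 * m) → s ≡ In
sings-even⇒In In ℓ m _ = refl
sings-even⇒In Un ℓ m (j , _ , 2m≡2j+1) =
  contradiction (trans 2m≡2j+1 (+-comm (2 * j) 1)) (even≢odd m j)

module _ (X : Execution) where
  open Execution X

  In-sings-0 : ∀ k x → st k x ≡ In → Sings (st k x) (ℓ k x) 0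
  In-sings-0 k x x-In rewrite x-In = 0 , ℓ≥1 k x , refl

  hears-0⇒Out : ∀ k y → ¬ reset (suc k) y → Hears k y 0 → st (suc k) y ≡ Out
  hears-0⇒Out k y ¬reset (sung , ¬sings-0) with st k y | protocol k y ¬reset
  ... | Out | (→Out , _) = →Out (sung , ¬sings-0)
  ... | Un  | (→Out , _) = →Out (sung , ¬sings-0)
  ... | In  | _ = contradiction (0 , ℓ≥1 k y , refl) ¬sings-0

  In-neighbour⇒Out : ∀ k x y → ¬ reset (suc k) y → E k x y →
                     st k x ≡ In → st k y ≢ In → st (suc k) y ≡ Out
  In-neighbour⇒Out k x y ¬reset exy x-In y-¬In =
    hears-0⇒Out k y ¬reset
      ((x , exy , In-sings-0 k x x-In) , λ sings → y-¬In (sings-even⇒In _ _ 0 sings))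

  InNoIn⇒In : ∀ k x → ¬ reset (suc k) x → InNoIn k x → st (suc k) x ≡ In
  InNoIn⇒In k x ¬reset (x-In , noIn) with st k x | x-In | protocol k x ¬reset
  ... | In | refl | (_ , ¬heard→In) = ¬heard→In λ { ((y , eyx , sings) , _) →
    noIn y (E-sym k y x eyx) (sings-even⇒In _ _ (ℓ k x) sings) }

  neighbour-of-unaffected⇒unchanged : ∀ k v w u → ¬ Affected k v w → E k v u → ¬ Changed k u
  neighbour-of-unaffected⇒unchanged k v w u ¬affected evu changed =
    ¬affected (u , changed , inj₁ (inj₂ (inj₁ evu)))

  module _ {k : ℕ} {u : V} (unchanged : ¬ Changed (suc k) u) where

    unchanged⇒edge-existed : ∀ {y} → E (suc k) u y → ¬ ¬ E k u y
    unchanged⇒edge-existed {y} e′ ¬e = unchanged (y , inj₁ (e′ , ¬e))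

    unchanged⇒edge-kept : ∀ {y} → E k u y → ¬ ¬ E (suc k) u y
    unchanged⇒edge-kept {y} e ¬e′ = unchanged (y , inj₂ (inj₁ (e , ¬e′)))

    unchanged⇒¬reset : ∀ {y} → E k u y ⊎ E (suc k) u y → ¬ reset (suc k) u
    unchanged⇒¬reset {y} e r = unchanged (y , inj₂ (inj₂ (e , inj₁ r)))

    unchanged⇒neighbour-¬reset : ∀ {y} → E k u y ⊎ E (suc k) u y → ¬ reset (suc k) y
    unchanged⇒neighbour-¬reset {y} e r = unchanged (y , inj₂ (inj₂ (e , inj₂ r)))

    InNoIn-persists : ¬ reset (suc k) u → InNoIn k u → InNoIn (suc k) u
    InNoIn-persists ¬reset u-InNoIn@(u-In , noIn) =
      InNoIn⇒In k u ¬reset u-InNoIn , λ y e′ y-In′ → unchanged⇒edge-existed e′ λ e →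
        let y-Out′ = In-neighbour⇒Out k u y (unchanged⇒neighbour-¬reset (inj₁ e)) e u-In (noIn y e)
        in  contradiction (trans (sym y-Out′) y-In′) λ ()

    neighbour-of-InNoIn⇒¬Un : ∀ {x} → ¬ reset (suc (suc k)) u →
                              E k u x → InNoIn k x → st (suc (suc k)) u ≢ Un
    neighbour-of-InNoIn⇒¬Un {x} ¬reset₂ eux x-InNoIn@(x-In , noIn) u-Un₂ =
      unchanged⇒edge-kept eux λ eux′ →
        contradiction (trans (sym (u-Out₂ eux′)) u-Un₂) λ ()
      where
      u-Out₁ : st (suc k) u ≡ Out
      u-Out₁ = In-neighbour⇒Out k x u (unchanged⇒¬reset (inj₁ eux)) exu x-In (noIn u exu)
        where exu = E-sym k u x eux

      x-In₁ : st (suc k) x ≡ In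
      x-In₁ = InNoIn⇒In k x (unchanged⇒neighbour-¬reset (inj₁ eux)) x-InNoIn

      u-Out₂ : E (suc k) u x → st (suc (suc k)) u ≡ Out
      u-Out₂ eux′ = In-neighbour⇒Out (suc k) x u ¬reset₂ (E-sym (suc k) u x eux′) x-In₁
                      λ u-In₁ → contradiction (trans (sym u-Out₁) u-In₁) λ ()

    eliminated⇒¬Un : ¬ reset (suc k) u → ¬ reset (suc (suc k)) u →
                     Eliminated k u → st (suc (suc k)) u ≢ Un
    eliminated⇒¬Un ¬reset₁ ¬reset₂ (inj₁ u-InNoIn) u-Un₂ =
      let u-In₂ = InNoIn⇒In (suc k) u ¬reset₂ (InNoIn-persists ¬reset₁ u-InNoIn)
      in  contradiction (trans (sym u-In₂) u-Un₂) λ ()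
    eliminated⇒¬Un ¬reset₁ ¬reset₂ (inj₂ (x , eux , x-InNoIn)) =
      neighbour-of-InNoIn⇒¬Un ¬reset₂ eux x-InNoIn

lemma5 : (X : Execution) → let open Execution X in
         ∀ (i : ℕ) (v w u : V) →
         E (suc (suc i)) v w →
         ¬ Affected (suc i) v w →
         ¬ Affected (suc (suc i)) v w →
         E (suc (suc i)) v u →
         st (suc (suc i)) u ≡ Un →
         Active i u
lemma5 X i v w u _ ¬affected₁ ¬affected₂ evu u-Un eliminated =
  unchanged⇒edge-existed X unchanged₂ euv₂ λ euv₁ →
    let unchanged₁ = neighbour-of-unaffected⇒unchanged X (suc i) v w u ¬affected₁ (E-sym (suc i) u v euv₁)
    in  eliminated⇒¬Un X unchanged₁
          (unchanged⇒¬reset X unchanged₁ (inj₂ euv₁))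
          (unchanged⇒¬reset X unchanged₂ (inj₂ euv₂))
          eliminated u-Un
  where
  open Execution X
  euv₂ : E (suc (suc i)) u v
  euv₂ = E-sym (suc (suc i)) v u evu
  unchanged₂ : ¬ Changed (suc (suc i)) u
  unchanged₂ = neighbour-of-unaffected⇒unchanged X (suc (suc i)) v w u ¬affected₂ evu
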